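{- Let $\ell\geq1$, let $G$ be a graph and let $(X,Y)$ be a strict reducible pair in $G$. Then every optimal solution of the linear program $$\min \sum_{v\in V(G)}x_v \quad\text{s.t.}\quad \sum_{v\in C}x_v\geq 1 \text{ for every } C\subseteq V(G) \text{ with } |C|=\ell+1 \text{ and } G[C] \text{ connected},\qquad 0\leq x_v\leq 1 \text{ for all } v\in V(G)$$ sets $x_v=1$ for at least one vertex $v\in X$.
   Context: For $Y\subseteq V(G)$, $N(Y)$ is the set of vertices outside $Y$ adjacent to some vertex of $Y$. For disjoint $X,Y\subseteq V(G)$, $\tilde{G}_{XY}$ is the bipartite graph with parts $X$ and $\tilde{Y}$, where $\tilde{Y}$ contains one vertex $c_C$ for each connected component $C$ of $G[Y]$, $x\in X$ is adjacent to $c_C$ iff $x$ has a neighbour in $C$, and $c_C$ has capacity $w(c_C)=|V(C)|$. A weighted $q$-expansion in $\tilde{G}_{XY}$ is an edge weight function $f:E(\tilde{G}_{XY})\to\mathbb{N}$ with $\sum_{x}f(xc)\leq w(c)$ for every $c\in\tilde{Y}$ and $\sum_{c}f(xc)\geq q$ for every $x\in X$; it is strict if additionally $\sum_{c}f(rc)\geq q+1$ for at least one $r\in X$. A pair $(X,Y)$ of disjoint subsets of $V(G)$ is a (strict) reducible pair if $N(Y)\subseteq X$, every connected component of $G[Y]$ has at most $\ell$ vertices, and there is a (strict) weighted $(2\ell-1)$-expansion in $\tilde{G}_{XY}$.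
   Formalization: The optimal solutions of the linear program are taken over ℚ: every $x_v$ is rational, and optimality is measured only against rational feasible points. -}

module Defs where

open import Data.Nat using (ℕ; zero; suc; _+_; _*_; _∸_; _≤_)
open import Data.Fin using (Fin)
open import Data.Fin.Subset using (Subset; _∈_; _∉_; _⊆_; ∣_∣; Nonempty)
open import Data.Bool using (Bool; true; false; if_then_else_)
open import Data.Vec using (Vec; []; _∷_; lookup)
open import Data.List using (List; []; _∷_; map; _++_; foldr)
open import Data.Product using (Σ; ∃; _×_; _,_)
open import Data.Rational using (ℚ; 0ℚ; 1ℚ) renaming (_+_ to _+ℚ_; _≤_ to _≤ℚ_)
open import Relation.Nullary using (¬_)
open import Relation.Binary.PropositionalEquality using (_≡_; _≢_)

record Graph (n : ℕ) : Set₁ where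
  field
    Adj   : Fin n → Fin n → Set
    sym   : ∀ {u v} → Adj u v → Adj v u
    irrefl : ∀ {u} → ¬ Adj u u
open Graph public

sumℕ : ∀ {n} → (Fin n → ℕ) → ℕ
sumℕ {zero}  f = 0
sumℕ {suc n} f = f Fin.zero + sumℕ (λ i → f (Fin.suc i))

sumℚ : ∀ {n} → (Fin n → ℚ) → ℚ
sumℚ {zero}  f = 0ℚ
sumℚ {suc n} f = f Fin.zero +ℚ sumℚ (λ i → f (Fin.suc i))

sumOver : ∀ {n} → Subset n → (Fin n → ℚ) → ℚ
sumOver C x = sumℚ (λ v → if lookup C v then x v else 0ℚ)

allSubsets : ∀ n → List (Subset n)
allSubsets zero    = [] ∷ []
allSubsets (suc n) = map (true ∷_) (allSubsets n) ++ map (false ∷_) (allSubsets n)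

sumSubsets : ∀ {n} → (Subset n → ℕ) → ℕ
sumSubsets {n} f = foldr (λ C s → f C + s) 0 (allSubsets n)

data WalkIn {n} (G : Graph n) (S : Subset n) : Fin n → Fin n → Set where
  here : ∀ {u} → u ∈ S → WalkIn G S u u
  step : ∀ {u w v} → u ∈ S → Adj G u w → WalkIn G S w v → WalkIn G S u v

ConnectedInduced : ∀ {n} → Graph n → Subset n → Set
ConnectedInduced G S = Nonempty S × (∀ {u v} → u ∈ S → v ∈ S → WalkIn G S u v)

IsComponent : ∀ {n} → Graph n → Subset n → Subset n → Set
IsComponent G Y C = C ⊆ Y × ConnectedInduced G C
  × (∀ {u v} → u ∈ C → v ∈ Y → Adj G u v → v ∈ C)

-- Weighted q-expansion in G̃_{XY}: f x C is the weight of edge x c_C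
-- (f x C must vanish unless x ∈ X, C is a component of G[Y] and x has a
-- neighbour in C; the capacity of c_C is |C|).
record WeightedExpansion {n} (G : Graph n) (X Y : Subset n) (q : ℕ) : Set where
  field
    f        : Fin n → Subset n → ℕ
    support  : ∀ x C → f x C ≢ 0 →
               x ∈ X × IsComponent G Y C × ∃ (λ y → y ∈ C × Adj G x y)
    capacity : ∀ C → IsComponent G Y C → sumℕ (λ x → f x C) ≤ ∣ C ∣
    demand   : ∀ x → x ∈ X → q ≤ sumSubsets (f x)

StrictWeightedExpansion : ∀ {n} → Graph n → Subset n → Subset n → ℕ → Set
StrictWeightedExpansion G X Y q =
  Σ (WeightedExpansion G X Y q) λ e →
    ∃ λ r → r ∈ X × suc q ≤ sumSubsets (WeightedExpansion.f e r)

StrictReduciblePair : ∀ {n} → ℕ → Graph n → Subset n → Subset n → Set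
StrictReduciblePair ℓ G X Y =
    (∀ {v} → v ∈ X → v ∉ Y)
  × (∀ {y v} → y ∈ Y → v ∉ Y → Adj G y v → v ∈ X)
  × (∀ C → IsComponent G Y C → ∣ C ∣ ≤ ℓ)
  × StrictWeightedExpansion G X Y (2 * ℓ ∸ 1)

Feasible : ∀ {n} → ℕ → Graph n → (Fin n → ℚ) → Set
Feasible ℓ G x =
    (∀ v → (0ℚ ≤ℚ x v) × (x v ≤ℚ 1ℚ))
  × (∀ C → ∣ C ∣ ≡ suc ℓ → ConnectedInduced G C → 1ℚ ≤ℚ sumOver C x)

Optimal : ∀ {n} → ℕ → Graph n → (Fin n → ℚ) → Set
Optimal ℓ G x = Feasible ℓ G x × (∀ y → Feasible ℓ G y → sumℚ x ≤ℚ sumℚ y)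

module Submission where

-- Suppose x is optimal but x_r < 1, where r ∈ X is the vertex receiving more than 2ℓ − 1 units
-- of the expansion f. Round x up to 1 on X and down to 0 on Y. The result is still feasible:
-- a connected (ℓ+1)-set that avoids X cannot meet Y, because N(Y) ⊆ X would trap it inside a
-- component of G[Y], which has at most ℓ vertices. Rounding costs Σ_{u∈X} (1 − x_u) and saves
-- x(Y); we show that the saving is larger.
-- Give each component C of G[Y] the density x(C)/|C|. For u ∈ X, any family of components
-- adjacent to u spans, together with u, a connected set, so if their sizes add up to at least ℓ
-- their mass is at least 1 − x_u. Taking these components greedily by increasing density, and
-- using that each has at most ℓ vertices while u sends out at least 2ℓ − 1 units with
-- f(u,C) ≤ |C|, gives 1 − x_u ≤ Σ_C f(u,C) · density(C), strictly for u = r. As each C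
-- receives at most |C| units in total, the sum of the right-hand sides over u is at most x(Y).

open import Defs hiding (sym)
open import Algebra.Bundles using (CommutativeMonoid)
open import Data.Bool.Base using (true; false; _∨_; if_then_else_)
open import Data.Empty using (⊥-elim)
open import Data.Fin.Base using (Fin)
open import Data.Fin.Properties using (any?)
open import Data.Fin.Subset using (Subset; _∈_; _∉_; _⊆_; ∣_∣; _∪_; ⁅_⁆; ⋃; ⊥)
open import Data.Fin.Subset.Properties
  using (_∈?_; x∈p∪q⁻; x∈p∪q⁺; x∈⁅x⁆; x∈⁅y⁆⇒x≡y; ∉⊥; p⊆q⇒∣p∣≤∣q∣; ∣⁅x⁆∣≡1; ∣⊥∣≡0; ⊆-antisym; x∈p⇒∣p-x∣<∣p∣)
open import Data.List.Base using (List; []; _∷_; foldr; filter; take; map)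
open import Data.List.Membership.Propositional using () renaming (_∈_ to _∈ₗ_)
open import Data.List.Membership.Propositional.Properties using (∈-map⁻)
open import Data.List.Relation.Binary.Permutation.Propositional as ↭ using (_↭_)
import Data.List.Relation.Binary.Permutation.Propositional.Properties as ↭
import Data.List.Relation.Binary.Permutation.Setoid.Properties as ↭ₛ
open import Data.List.Relation.Unary.All as All using (All; []; _∷_)
import Data.List.Relation.Unary.All.Properties as All
open import Data.List.Relation.Unary.AllPairs using (AllPairs; []; _∷_)
open import Data.List.Relation.Unary.Any using (here; there)
open import Data.List.Relation.Unary.Linked.Properties using (Linked⇒AllPairs)
open import Data.List.Relation.Unary.Unique.Propositional using (Unique)
import Data.List.Relation.Unary.Unique.Propositional.Properties as Unique
open import Data.Nat.Base as ℕ using (ℕ; zero; suc; z≤n; s≤s; _+_; _*_; _∸_; _≤_; _<_)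
import Data.Nat.Properties as ℕ
open import Data.Nat.Tactic.RingSolver using (solve-∀)
open import Data.Product using (∃; ∃₂; _×_; _,_; proj₁; proj₂)
open import Data.Rational.Base as ℚ using (ℚ; 0ℚ; 1ℚ; _÷_)
  renaming (_+_ to _+ℚ_; _*_ to _*ℚ_; _≤_ to _≤ℚ_; _<_ to _<ℚ_)
import Data.Rational.Properties as ℚ
open import Data.Sum using (inj₁; inj₂; [_,_]′)
open import Data.Vec.Base using ([]; _∷_; here; there; lookup; tabulate)
import Data.Vec.Properties as Vec
open import Data.Vec.Properties
  using ([]=⇒lookup; lookup⇒[]=; lookup-zipWith; lookup-replicate; lookup∘tabulate)
open import Function.Base using (_∘_)
open import Level using (0ℓ)
import Relation.Binary.Construct.On as On
open import Relation.Binary.PropositionalEquality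
  using (setoid; _≡_; _≢_; refl; sym; trans; cong; cong₂; subst; subst₂; module ≡-Reasoning)
open import Relation.Nullary using (¬_; Dec; does; yes; no; contradiction)
open import Relation.Nullary.Decidable
  using (decidable-stable; dec-true; dec-false; _×-dec_; ¬?; ¬¬-excluded-middle)
open import Relation.Nullary.Negation using (¬¬-map)
open import Relation.Unary using (Decidable)

open import Algebra.Properties.Monoid.Mult ℚ.+-0-monoid using ()
  renaming (_×_ to _·_; ×-homo-+ to ·-homo-+)
open import Algebra.Properties.CommutativeSemigroup
  (CommutativeMonoid.commutativeSemigroup ℚ.+-0-commutativeMonoid) using (interchange; xy∙z≈xz∙y)

·-nonneg : ∀ n {q} → 0ℚ ≤ℚ q → 0ℚ ≤ℚ n · q
·-nonneg zero    _   = ℚ.≤-refl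
·-nonneg (suc n) 0≤q = ℚ.+-mono-≤ 0≤q (·-nonneg n 0≤q)

·-pos : ∀ n {q} → 0ℚ <ℚ q → 0ℚ <ℚ suc n · q
·-pos n 0<q = ℚ.+-mono-<-≤ 0<q (·-nonneg n (ℚ.<⇒≤ 0<q))

·-monoʳ-≤ : ∀ n {p q} → p ≤ℚ q → n · p ≤ℚ n · q
·-monoʳ-≤ zero    _   = ℚ.≤-refl
·-monoʳ-≤ (suc n) p≤q = ℚ.+-mono-≤ p≤q (·-monoʳ-≤ n p≤q)

·-monoˡ-≤ : ∀ {m n q} → 0ℚ ≤ℚ q → m ≤ n → m · q ≤ℚ n · q
·-monoˡ-≤ {m} {n} {q} 0≤q m≤n with ℕ.m≤n⇒∃[o]m+o≡n m≤n
... | k , refl = begin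
  m · q           ≡⟨ sym (ℚ.+-identityʳ (m · q)) ⟩
  m · q +ℚ 0ℚ     ≤⟨ ℚ.+-monoʳ-≤ (m · q) (·-nonneg k 0≤q) ⟩
  m · q +ℚ k · q  ≡⟨ sym (·-homo-+ q m k) ⟩
  (m + k) · q     ∎
  where open ℚ.≤-Reasoning

·-zeroʳ : ∀ n → n · 0ℚ ≡ 0ℚ
·-zeroʳ zero    = refl
·-zeroʳ (suc n) = cong (0ℚ +ℚ_) (·-zeroʳ n)

·-*ˡ : ∀ n q → n · q ≡ (n · 1ℚ) *ℚ q
·-*ˡ zero    q = sym (ℚ.*-zeroˡ q)
·-*ˡ (suc n) q = begin
  q +ℚ n · q                ≡⟨ cong₂ _+ℚ_ (sym (ℚ.*-identityˡ q)) (·-*ˡ n q) ⟩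
  1ℚ *ℚ q +ℚ (n · 1ℚ) *ℚ q  ≡⟨ sym (ℚ.*-distribʳ-+ q 1ℚ (n · 1ℚ)) ⟩
  (1ℚ +ℚ n · 1ℚ) *ℚ q       ∎
  where open ≡-Reasoning

suc·1-positive : ∀ k → ℚ.Positive (suc k · 1ℚ)
suc·1-positive k = ℚ.positive (·-pos k (ℚ.positive⁻¹ 1ℚ))

suc·1-nonZero : ∀ k → ℚ.NonZero (suc k · 1ℚ)
suc·1-nonZero k = ℚ.pos⇒nonZero (suc k · 1ℚ) {{suc·1-positive k}}

-- s / m, with the junk value 0 for m = 0
mean : ℚ → ℕ → ℚ
mean s zero    = 0ℚ
mean s (suc k) = (s ÷ (suc k · 1ℚ)) {{suc·1-nonZero k}}

·-mean : ∀ {m} s → 1 ≤ m → m · mean s m ≡ s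
·-mean {suc k} s _ = begin
  suc k · (s *ℚ q⁻¹)  ≡⟨ ·-*ˡ (suc k) _ ⟩
  q *ℚ (s *ℚ q⁻¹)     ≡⟨ cong (q *ℚ_) (ℚ.*-comm s q⁻¹) ⟩
  q *ℚ (q⁻¹ *ℚ s)     ≡⟨ sym (ℚ.*-assoc q q⁻¹ s) ⟩
  (q *ℚ q⁻¹) *ℚ s     ≡⟨ cong (_*ℚ s) (ℚ.*-inverseʳ q {{suc·1-nonZero k}}) ⟩
  1ℚ *ℚ s             ≡⟨ ℚ.*-identityˡ s ⟩
  s                   ∎
  where
  open ≡-Reasoning
  q   = suc k · 1ℚ
  q⁻¹ = (ℚ.1/ q) {{suc·1-nonZero k}}

0≤mean : ∀ {s} m → 0ℚ ≤ℚ s → 0ℚ ≤ℚ mean s m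
0≤mean     zero    _   = ℚ.≤-refl
0≤mean {s} (suc k) 0≤s =
  subst (_≤ℚ mean s (suc k)) (ℚ.*-zeroˡ q⁻¹) (ℚ.*-monoʳ-≤-nonNeg q⁻¹ {{0≤q⁻¹}} 0≤s)
  where
  q⁻¹ = (ℚ.1/ (suc k · 1ℚ)) {{suc·1-nonZero k}}
  0≤q⁻¹ : ℚ.NonNegative q⁻¹
  0≤q⁻¹ = ℚ.pos⇒nonNeg q⁻¹ {{ℚ.1/pos⇒pos (suc k · 1ℚ) {{suc·1-positive k}}}}

+-cancelʳ-≤ : ∀ {p q} r → p +ℚ r ≤ℚ q +ℚ r → p ≤ℚ q
+-cancelʳ-≤ r p+r≤q+r =
  ℚ.≮⇒≥ (λ q<p → ℚ.<-irrefl refl (ℚ.<-≤-trans (ℚ.+-monoˡ-< r q<p) p+r≤q+r))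

sumℚ-cong : ∀ {n} {f g : Fin n → ℚ} → (∀ i → f i ≡ g i) → sumℚ f ≡ sumℚ g
sumℚ-cong {zero}  _   = refl
sumℚ-cong {suc n} f≗g = cong₂ _+ℚ_ (f≗g Fin.zero) (sumℚ-cong (f≗g ∘ Fin.suc))

sumℚ-+ : ∀ {n} (f g : Fin n → ℚ) → sumℚ (λ i → f i +ℚ g i) ≡ sumℚ f +ℚ sumℚ g
sumℚ-+ {zero}  _ _ = refl
sumℚ-+ {suc n} f g = trans (cong (f Fin.zero +ℚ g Fin.zero +ℚ_) (sumℚ-+ (f ∘ Fin.suc) (g ∘ Fin.suc)))
                           (interchange (f Fin.zero) (g Fin.zero) _ _)

sumℚ-mono-≤ : ∀ {n} {f g : Fin n → ℚ} → (∀ i → f i ≤ℚ g i) → sumℚ f ≤ℚ sumℚ g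
sumℚ-mono-≤ {zero}  _   = ℚ.≤-refl
sumℚ-mono-≤ {suc n} f≤g = ℚ.+-mono-≤ (f≤g Fin.zero) (sumℚ-mono-≤ (f≤g ∘ Fin.suc))

sumℚ-mono-< : ∀ {n} {f g : Fin n → ℚ} → (∀ i → f i ≤ℚ g i) → ∀ j → f j <ℚ g j → sumℚ f <ℚ sumℚ g
sumℚ-mono-< f≤g Fin.zero    fj<gj = ℚ.+-mono-<-≤ fj<gj (sumℚ-mono-≤ (f≤g ∘ Fin.suc))
sumℚ-mono-< f≤g (Fin.suc j) fj<gj = ℚ.+-mono-≤-< (f≤g Fin.zero) (sumℚ-mono-< (f≤g ∘ Fin.suc) j fj<gj)

sumℚ-zero : ∀ n → sumℚ {n} (λ _ → 0ℚ) ≡ 0ℚ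
sumℚ-zero zero    = refl
sumℚ-zero (suc n) = cong (0ℚ +ℚ_) (sumℚ-zero n)

sumℚ-nonneg : ∀ {n} {f : Fin n → ℚ} → (∀ i → 0ℚ ≤ℚ f i) → 0ℚ ≤ℚ sumℚ f
sumℚ-nonneg {n} {f} 0≤f = subst (_≤ℚ sumℚ f) (sumℚ-zero n) (sumℚ-mono-≤ 0≤f)

term≤sumℚ : ∀ {n} {f : Fin n → ℚ} → (∀ i → 0ℚ ≤ℚ f i) → ∀ j → f j ≤ℚ sumℚ f
term≤sumℚ {f = f} 0≤f Fin.zero =
  subst (_≤ℚ sumℚ f) (ℚ.+-identityʳ (f Fin.zero)) (ℚ.+-monoʳ-≤ (f Fin.zero) (sumℚ-nonneg (0≤f ∘ Fin.suc)))
term≤sumℚ {f = f} 0≤f (Fin.suc j) =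
  subst (_≤ℚ sumℚ f) (ℚ.+-identityˡ (f (Fin.suc j))) (ℚ.+-mono-≤ (0≤f Fin.zero) (term≤sumℚ (0≤f ∘ Fin.suc) j))

sumℚ-· : ∀ {n} (f : Fin n → ℕ) q → sumℚ (λ i → f i · q) ≡ sumℕ f · q
sumℚ-· {zero}  _ _ = refl
sumℚ-· {suc n} f q = trans (cong (f Fin.zero · q +ℚ_) (sumℚ-· (f ∘ Fin.suc) q))
                           (sym (·-homo-+ q (f Fin.zero) _))

term≤sumℕ : ∀ {n} (f : Fin n → ℕ) j → f j ≤ sumℕ f
term≤sumℕ f Fin.zero    = ℕ.m≤m+n _ _
term≤sumℕ f (Fin.suc j) = ℕ.≤-trans (term≤sumℕ (f ∘ Fin.suc) j) (ℕ.m≤n+m _ (f Fin.zero))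

sumℕ≢0⇒term≢0 : ∀ {n} (f : Fin n → ℕ) → sumℕ f ≢ 0 → ∃ λ j → f j ≢ 0
sumℕ≢0⇒term≢0 {zero}  f sum≢0 = contradiction refl sum≢0
sumℕ≢0⇒term≢0 {suc n} f sum≢0 with f Fin.zero ℕ.≟ 0
... | no  f₀≢0 = Fin.zero , f₀≢0
... | yes f₀≡0 with sumℕ≢0⇒term≢0 (f ∘ Fin.suc) (sum≢0 ∘ cong₂ _+_ f₀≡0)
...   | j , fj≢0 = Fin.suc j , fj≢0

module ListSum (M : CommutativeMonoid 0ℓ 0ℓ) where

  open CommutativeMonoid M
    using (_≈_; _∙_; ε; ∙-cong; ∙-congˡ; ∙-congʳ; identityˡ; commutativeSemigroup)
    renaming (Carrier to A; refl to ≈-refl; sym to ≈-sym; trans to ≈-trans)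
  open import Algebra.Properties.CommutativeSemigroup commutativeSemigroup using (x∙yz≈y∙xz)

  sum : {I : Set} → (I → A) → List I → A
  sum g = foldr (λ i s → g i ∙ s) ε

  sum-cong : ∀ {I : Set} {f g : I → A} → (∀ i → f i ≈ g i) → ∀ xs → sum f xs ≈ sum g xs
  sum-cong f≈g []       = ≈-refl
  sum-cong f≈g (x ∷ xs) = ∙-cong (f≈g x) (sum-cong f≈g xs)

  sum-↭ : ∀ {I : Set} (g : I → A) {xs ys} → xs ↭ ys → sum g xs ≈ sum g ys
  sum-↭ g ↭.refl                = ≈-refl
  sum-↭ g (↭.prep x xs↭ys)      = ∙-congˡ (sum-↭ g xs↭ys)
  sum-↭ g (↭.swap x y xs↭ys)    = ≈-trans (∙-congˡ (∙-congˡ (sum-↭ g xs↭ys))) (x∙yz≈y∙xz (g x) (g y) _)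
  sum-↭ g (↭.trans xs↭ys ys↭zs) = ≈-trans (sum-↭ g xs↭ys) (sum-↭ g ys↭zs)

  sum-filter : ∀ {I : Set} (g : I → A) {P : I → Set} (P? : Decidable P) →
               (∀ i → ¬ P i → g i ≈ ε) → ∀ xs → sum g (filter P? xs) ≈ sum g xs
  sum-filter g P? g≈ε []       = ≈-refl
  sum-filter g P? g≈ε (x ∷ xs) with P? x
  ... | yes _  = ∙-congˡ (sum-filter g P? g≈ε xs)
  ... | no ¬px =
    ≈-trans (sum-filter g P? g≈ε xs) (≈-trans (≈-sym (identityˡ _)) (∙-congʳ (≈-sym (g≈ε x ¬px))))

module Σℕ = ListSum ℕ.+-0-commutativeMonoid
module Σℚ = ListSum ℚ.+-0-commutativeMonoid

Σℚ-mono-≤ : ∀ {I : Set} {f g : I → ℚ} {xs} → All (λ i → f i ≤ℚ g i) xs → Σℚ.sum f xs ≤ℚ Σℚ.sum g xs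
Σℚ-mono-≤ []            = ℚ.≤-refl
Σℚ-mono-≤ (fx≤gx ∷ f≤g) = ℚ.+-mono-≤ fx≤gx (Σℚ-mono-≤ f≤g)

Σℚ-nonneg : ∀ {I : Set} {f : I → ℚ} → (∀ i → 0ℚ ≤ℚ f i) → ∀ xs → 0ℚ ≤ℚ Σℚ.sum f xs
Σℚ-nonneg 0≤f []       = ℚ.≤-refl
Σℚ-nonneg 0≤f (x ∷ xs) = ℚ.+-mono-≤ (0≤f x) (Σℚ-nonneg 0≤f xs)

Σℚ-· : ∀ {I : Set} (w : I → ℕ) q xs → Σℚ.sum (λ i → w i · q) xs ≡ Σℕ.sum w xs · q
Σℚ-· w q []       = refl
Σℚ-· w q (x ∷ xs) = trans (cong (w x · q +ℚ_) (Σℚ-· w q xs)) (sym (·-homo-+ q (w x) _))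

Σℚ-sumℚ-comm : ∀ {I : Set} {n} (g : I → Fin n → ℚ) xs →
               Σℚ.sum (λ i → sumℚ (g i)) xs ≡ sumℚ (λ v → Σℚ.sum (λ i → g i v) xs)
Σℚ-sumℚ-comm {n = n} g []       = sym (sumℚ-zero n)
Σℚ-sumℚ-comm         g (x ∷ xs) = trans (cong (sumℚ (g x) +ℚ_) (Σℚ-sumℚ-comm g xs)) (sym (sumℚ-+ (g x) _))

Disjoint : ∀ {n} → Subset n → Subset n → Set
Disjoint A B = ∀ {v} → v ∈ A → v ∉ B

⁅⁆⊆ : ∀ {n} {v} {S : Subset n} → v ∈ S → ⁅ v ⁆ ⊆ S
⁅⁆⊆ {v = v} {S} v∈S w∈⁅v⁆ = subst (_∈ S) (sym (x∈⁅y⁆⇒x≡y v w∈⁅v⁆)) v∈S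

∉⇒lookup≡false : ∀ {n} {S : Subset n} {v} → v ∉ S → lookup S v ≡ false
∉⇒lookup≡false {S = S} {v} v∉S with lookup S v in eq
... | true  = contradiction (lookup⇒[]= v S eq) v∉S
... | false = refl

∃∈∖ : ∀ {n} {A B : Subset n} → A ⊆ B → ∣ A ∣ < ∣ B ∣ → ∃ λ b → b ∈ B × b ∉ A
∃∈∖ {A = A} {B} A⊆B ∣A∣<∣B∣ with any? (λ v → (v ∈? B) ×-dec ¬? (v ∈? A))
... | yes found = found
... | no  none  = contradiction (p⊆q⇒∣p∣≤∣q∣ B⊆A) (ℕ.<⇒≱ ∣A∣<∣B∣)
  where
  B⊆A : B ⊆ A
  B⊆A {v} v∈B = decidable-stable (v ∈? A) (λ v∉A → none (v , v∈B , v∉A))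

∣∪∣-disjoint : ∀ {n} (A B : Subset n) → Disjoint A B → ∣ A ∪ B ∣ ≡ ∣ A ∣ + ∣ B ∣
∣∪∣-disjoint []      []      _    = refl
∣∪∣-disjoint (a ∷ A) (b ∷ B) disj with ∣∪∣-disjoint A B (λ v∈A → disj (there v∈A) ∘ there)
∣∪∣-disjoint (true  ∷ A) (true  ∷ B) disj | _  = contradiction here (disj here)
∣∪∣-disjoint (true  ∷ A) (false ∷ B) disj | eq = cong suc eq
∣∪∣-disjoint (false ∷ A) (true  ∷ B) disj | eq = trans (cong suc eq) (sym (ℕ.+-suc _ _))
∣∪∣-disjoint (false ∷ A) (false ∷ B) disj | eq = eq

Disjoint-⋃ : ∀ {n} {C : Subset n} T → All (Disjoint C) T → Disjoint C (⋃ T)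
Disjoint-⋃ []      _                  _   v∈⋃ = ∉⊥ v∈⋃
Disjoint-⋃ (D ∷ T) (C∩D=∅ ∷ C∩T=∅) v∈C v∈⋃ =
  [ C∩D=∅ v∈C , Disjoint-⋃ T C∩T=∅ v∈C ]′ (x∈p∪q⁻ D (⋃ T) v∈⋃)

⋃⊆ : ∀ {n} {Y : Subset n} T → All (_⊆ Y) T → ⋃ T ⊆ Y
⋃⊆ []      _                v∈⋃ = contradiction v∈⋃ ∉⊥
⋃⊆ (C ∷ T) (C⊆Y ∷ T⊆Y) v∈⋃ = [ C⊆Y , ⋃⊆ T T⊆Y ]′ (x∈p∪q⁻ C (⋃ T) v∈⋃)

∣⋃∣-disjoint : ∀ {n} (T : List (Subset n)) → AllPairs Disjoint T → ∣ ⋃ T ∣ ≡ Σℕ.sum ∣_∣ T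
∣⋃∣-disjoint {n} []      _                   = ∣⊥∣≡0 n
∣⋃∣-disjoint     (C ∷ T) (C∩T=∅ ∷ disjoint) =
  trans (∣∪∣-disjoint C (⋃ T) (Disjoint-⋃ T C∩T=∅)) (cong (∣ C ∣ +_) (∣⋃∣-disjoint T disjoint))

_↾_ : ∀ {n} → (Fin n → ℚ) → Subset n → Fin n → ℚ
(x ↾ C) v = if lookup C v then x v else 0ℚ

module _ {n} (x : Fin n → ℚ) where

  sumOver-cong : ∀ {y C} → (∀ {v} → v ∈ C → x v ≡ y v) → sumOver C x ≡ sumOver C y
  sumOver-cong {y} {C} x≗y = sumℚ-cong pointwise
    where
    pointwise : ∀ v → (x ↾ C) v ≡ (y ↾ C) v
    pointwise v with lookup C v in eq
    ... | true  = x≗y (lookup⇒[]= v C eq)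
    ... | false = refl

  sumOver-⊥ : sumOver ⊥ x ≡ 0ℚ
  sumOver-⊥ =
    trans (sumℚ-cong (λ v → cong (λ b → if b then x v else 0ℚ) (lookup-replicate v false))) (sumℚ-zero n)

  sumOver-∪ : ∀ {A B} → Disjoint A B → sumOver (A ∪ B) x ≡ sumOver A x +ℚ sumOver B x
  sumOver-∪ {A} {B} disj = trans (sumℚ-cong pointwise) (sumℚ-+ (x ↾ A) (x ↾ B))
    where
    pointwise : ∀ v → (x ↾ (A ∪ B)) v ≡ (x ↾ A) v +ℚ (x ↾ B) v
    pointwise v rewrite lookup-zipWith _∨_ v A B with lookup A v in eqA | lookup B v in eqB
    ... | true  | true  = contradiction (lookup⇒[]= v B eqB) (disj (lookup⇒[]= v A eqA))
    ... | true  | false = sym (ℚ.+-identityʳ (x v))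
    ... | false | true  = sym (ℚ.+-identityˡ (x v))
    ... | false | false = refl

  sumOver-⋃ : ∀ T → AllPairs Disjoint T → sumOver (⋃ T) x ≡ Σℚ.sum (λ C → sumOver C x) T
  sumOver-⋃ []      _                   = sumOver-⊥
  sumOver-⋃ (C ∷ T) (C∩T=∅ ∷ disjoint) =
    trans (sumOver-∪ (Disjoint-⋃ T C∩T=∅)) (cong (sumOver C x +ℚ_) (sumOver-⋃ T disjoint))

sumOver-⁅⁆ : ∀ {n} (x : Fin n → ℚ) u → sumOver ⁅ u ⁆ x ≡ x u
sumOver-⁅⁆ x Fin.zero    = trans (cong (x Fin.zero +ℚ_) (sumOver-⊥ (x ∘ Fin.suc))) (ℚ.+-identityʳ _)
sumOver-⁅⁆ x (Fin.suc u) = trans (ℚ.+-identityˡ _) (sumOver-⁅⁆ (x ∘ Fin.suc) u)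

module _ {n} {x : Fin n → ℚ} (0≤x : ∀ v → 0ℚ ≤ℚ x v) where

  0≤↾ : ∀ C v → 0ℚ ≤ℚ (x ↾ C) v
  0≤↾ C v with lookup C v
  ... | true  = 0≤x v
  ... | false = ℚ.≤-refl

  sumOver-nonneg : ∀ C → 0ℚ ≤ℚ sumOver C x
  sumOver-nonneg C = sumℚ-nonneg (0≤↾ C)

  sumOver-mono-⊆ : ∀ {A B} → A ⊆ B → sumOver A x ≤ℚ sumOver B x
  sumOver-mono-⊆ {A} {B} A⊆B = sumℚ-mono-≤ pointwise
    where
    pointwise : ∀ v → (x ↾ A) v ≤ℚ (x ↾ B) v
    pointwise v with lookup A v in eq
    ... | true rewrite []=⇒lookup (A⊆B (lookup⇒[]= v A eq)) = ℚ.≤-refl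
    ... | false = 0≤↾ B v

  term≤sumOver : ∀ {C v} → v ∈ C → x v ≤ℚ sumOver C x
  term≤sumOver {C} {v} v∈C =
    subst (_≤ℚ sumOver C x) (cong (λ b → if b then x v else 0ℚ) ([]=⇒lookup v∈C)) (term≤sumℚ (0≤↾ C) v)

-- Walks and connected sets

module _ {n} {G : Graph n} where

  walk-start : ∀ {S a b} → WalkIn G S a b → a ∈ S
  walk-start (here a∈S)     = a∈S
  walk-start (step a∈S _ _) = a∈S

  walk-end : ∀ {S a b} → WalkIn G S a b → b ∈ S
  walk-end (here b∈S)      = b∈S
  walk-end (step _ _ walk) = walk-end walk

  infixr 5 _++ʷ_

  _++ʷ_ : ∀ {S a b c} → WalkIn G S a b → WalkIn G S b c → WalkIn G S a c
  here _            ++ʷ walk′ = walk′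
  step a∈S adj walk ++ʷ walk′ = step a∈S adj (walk ++ʷ walk′)

  reverseʷ : ∀ {S a b} → WalkIn G S a b → WalkIn G S b a
  reverseʷ (here a∈S)          = here a∈S
  reverseʷ (step a∈S adj walk) = reverseʷ walk ++ʷ step (walk-start walk) (Graph.sym G adj) (here a∈S)

  walk-lift : ∀ {S S′ a b} → S ⊆ S′ → WalkIn G S a b → WalkIn G S′ a b
  walk-lift S⊆S′ (here a∈S)          = here (S⊆S′ a∈S)
  walk-lift S⊆S′ (step a∈S adj walk) = step (S⊆S′ a∈S) adj (walk-lift S⊆S′ walk)

  first-exit : ∀ {A B a b} → WalkIn G B a b → a ∈ A → b ∉ A →
               ∃₂ λ p q → p ∈ A × q ∈ B × q ∉ A × Adj G p q
  first-exit (here _) a∈A b∉A = contradiction a∈A b∉A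
  first-exit {A} (step {w = w} _ adj walk) a∈A b∉A with w ∈? A
  ... | yes w∈A = first-exit walk w∈A b∉A
  ... | no  w∉A = _ , w , a∈A , walk-start walk , w∉A , adj

  connected-hub : ∀ {S h} → h ∈ S → (∀ {v} → v ∈ S → WalkIn G S v h) → ConnectedInduced G S
  connected-hub h∈S to-h = (_ , h∈S) , λ u∈S v∈S → to-h u∈S ++ʷ reverseʷ (to-h v∈S)

  connected-⁅⁆ : ∀ v → ConnectedInduced G ⁅ v ⁆
  connected-⁅⁆ v = connected-hub (x∈⁅x⁆ v) λ {w} w∈⁅v⁆ →
    subst (λ u → WalkIn G ⁅ v ⁆ u v) (sym (x∈⁅y⁆⇒x≡y v w∈⁅v⁆)) (here (x∈⁅x⁆ v))

  connected-∪⁅⁆ : ∀ {A p q} → ConnectedInduced G A → p ∈ A → Adj G p q → ConnectedInduced G (A ∪ ⁅ q ⁆)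
  connected-∪⁅⁆ {A} {p} {q} (_ , walksA) p∈A adj = connected-hub p∈A∪q to-p
    where
    p∈A∪q : p ∈ A ∪ ⁅ q ⁆
    p∈A∪q = x∈p∪q⁺ (inj₁ p∈A)
    to-p : ∀ {v} → v ∈ A ∪ ⁅ q ⁆ → WalkIn G (A ∪ ⁅ q ⁆) v p
    to-p v∈A∪q with x∈p∪q⁻ A ⁅ q ⁆ v∈A∪q
    ... | inj₁ v∈A = walk-lift (x∈p∪q⁺ ∘ inj₁) (walksA v∈A p∈A)
    ... | inj₂ v∈⁅q⁆ rewrite x∈⁅y⁆⇒x≡y q v∈⁅q⁆ = step v∈A∪q (Graph.sym G adj) (here p∈A∪q)

  connected-extend : ∀ {A B} → A ⊆ B → ConnectedInduced G A → ConnectedInduced G B → ∣ A ∣ < ∣ B ∣ →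
                     ∃ λ A′ → A′ ⊆ B × ConnectedInduced G A′ × ∣ A′ ∣ ≡ suc ∣ A ∣
  connected-extend {A} {B} A⊆B connA@((a , a∈A) , _) (_ , walksB) ∣A∣<∣B∣ with ∃∈∖ A⊆B ∣A∣<∣B∣
  ... | b , b∈B , b∉A with first-exit (walksB (A⊆B a∈A) b∈B) a∈A b∉A
  ... | p , q , p∈A , q∈B , q∉A , adj = A ∪ ⁅ q ⁆ , A∪q⊆B , connected-∪⁅⁆ connA p∈A adj , ∣A∪q∣
    where
    A∪q⊆B : A ∪ ⁅ q ⁆ ⊆ B
    A∪q⊆B v∈A∪q = [ A⊆B , ⁅⁆⊆ q∈B ]′ (x∈p∪q⁻ A ⁅ q ⁆ v∈A∪q)
    ∣A∪q∣ : ∣ A ∪ ⁅ q ⁆ ∣ ≡ suc ∣ A ∣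
    ∣A∪q∣ = begin
      ∣ A ∪ ⁅ q ⁆ ∣      ≡⟨ ∣∪∣-disjoint A ⁅ q ⁆ (λ v∈A v∈⁅q⁆ → q∉A (subst (_∈ A) (x∈⁅y⁆⇒x≡y q v∈⁅q⁆) v∈A)) ⟩
      ∣ A ∣ + ∣ ⁅ q ⁆ ∣  ≡⟨ cong (∣ A ∣ +_) (∣⁅x⁆∣≡1 q) ⟩
      ∣ A ∣ + 1          ≡⟨ ℕ.+-comm ∣ A ∣ 1 ⟩
      suc ∣ A ∣          ∎
      where open ≡-Reasoning

  connected-grow : ∀ j {A B} → A ⊆ B → ConnectedInduced G A → ConnectedInduced G B → ∣ A ∣ + j ≤ ∣ B ∣ →
                   ∃ λ S → S ⊆ B × ConnectedInduced G S × ∣ S ∣ ≡ ∣ A ∣ + j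
  connected-grow zero    {A} A⊆B connA _ _ = A , A⊆B , connA , sym (ℕ.+-identityʳ _)
  connected-grow (suc j) {A} {B} A⊆B connA connB size
    with connected-extend A⊆B connA connB (ℕ.<-≤-trans (ℕ.m<m+n ∣ A ∣ (s≤s z≤n)) size)
  ... | A′ , A′⊆B , connA′ , ∣A′∣ with connected-grow j A′⊆B connA′ connB
         (subst (λ s → s + j ≤ ∣ B ∣) (sym ∣A′∣) (subst (_≤ ∣ B ∣) (ℕ.+-suc ∣ A ∣ j) size))
  ... | S , S⊆B , connS , ∣S∣ = S , S⊆B , connS , trans ∣S∣ (trans (cong (_+ j) ∣A′∣) (sym (ℕ.+-suc _ j)))

  connected-subset : ∀ {B k} → ConnectedInduced G B → suc k ≤ ∣ B ∣ →
                     ∃ λ S → S ⊆ B × ConnectedInduced G S × ∣ S ∣ ≡ suc k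
  connected-subset {B} {k} connB@((b , b∈B) , _) size
    with connected-grow k (⁅⁆⊆ b∈B) (connected-⁅⁆ b) connB
                        (subst (λ s → s + k ≤ ∣ B ∣) (sym (∣⁅x⁆∣≡1 b)) size)
  ... | S , S⊆B , connS , ∣S∣ = S , S⊆B , connS , trans ∣S∣ (cong (_+ k) (∣⁅x⁆∣≡1 b))

  Attached : Fin n → Subset n → Set
  Attached u C = ConnectedInduced G C × ∃ λ c → c ∈ C × Adj G u c

  ⋃-walk-to : ∀ {S u v} T → All (Attached u) T → ⋃ T ⊆ S → u ∈ S → v ∈ ⋃ T → WalkIn G S v u
  ⋃-walk-to []      _ _ _ v∈⋃ = contradiction v∈⋃ ∉⊥
  ⋃-walk-to (C ∷ T) (((_ , walksC) , c , c∈C , adj) ∷ attached) ⋃⊆S u∈S v∈⋃ with x∈p∪q⁻ C (⋃ T) v∈⋃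
  ... | inj₁ v∈C  = walk-lift C⊆S (walksC v∈C c∈C) ++ʷ step (C⊆S c∈C) (Graph.sym G adj) (here u∈S)
    where
    C⊆S : C ⊆ _
    C⊆S = ⋃⊆S ∘ x∈p∪q⁺ ∘ inj₁
  ... | inj₂ v∈⋃T = ⋃-walk-to T attached (⋃⊆S ∘ x∈p∪q⁺ ∘ inj₂) u∈S v∈⋃T

  connected-⁅⁆∪⋃ : ∀ {u} T → All (Attached u) T → ConnectedInduced G (⁅ u ⁆ ∪ ⋃ T)
  connected-⁅⁆∪⋃ {u} T attached = connected-hub u∈star to-u
    where
    u∈star : u ∈ ⁅ u ⁆ ∪ ⋃ T
    u∈star = x∈p∪q⁺ (inj₁ (x∈⁅x⁆ u))
    to-u : ∀ {v} → v ∈ ⁅ u ⁆ ∪ ⋃ T → WalkIn G (⁅ u ⁆ ∪ ⋃ T) v u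
    to-u v∈star with x∈p∪q⁻ ⁅ u ⁆ (⋃ T) v∈star
    ... | inj₁ v∈⁅u⁆ rewrite x∈⁅y⁆⇒x≡y u v∈⁅u⁆ = here u∈star
    ... | inj₂ v∈⋃T  = ⋃-walk-to T attached (x∈p∪q⁺ ∘ inj₂) u∈star v∈⋃T

feasible-connected : ∀ {ℓ n} {G : Graph n} {x B} → Feasible ℓ G x → ConnectedInduced G B → suc ℓ ≤ ∣ B ∣ →
                     1ℚ ≤ℚ sumOver B x
feasible-connected (bounds , covers) connB size with connected-subset connB size
... | S , S⊆B , connS , ∣S∣ = ℚ.≤-trans (covers S ∣S∣ connS) (sumOver-mono-⊆ (proj₁ ∘ bounds) S⊆B)

¬¬-decidable : ∀ {n} {P : Fin n → Set} → ¬ ¬ (∀ i → Dec (P i))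
¬¬-decidable {zero}      k = k (λ ())
¬¬-decidable {suc n} {P} k = ¬¬-excluded-middle λ P₀? → ¬¬-decidable {P = P ∘ Fin.suc} λ P? →
  k λ { Fin.zero → P₀? ; (Fin.suc i) → P? i }

module _ {n} {G : Graph n} {Y : Subset n} where

  component-closed : ∀ {C S a b} → IsComponent G Y C → S ⊆ Y → WalkIn G S a b → a ∈ C → b ∈ C
  component-closed _                      _   (here _)          a∈C = a∈C
  component-closed compC@(_ , _ , closed) S⊆Y (step _ adj walk) a∈C =
    component-closed compC S⊆Y walk (closed a∈C (S⊆Y (walk-start walk)) adj)

  component-unique : ∀ {C D v} → IsComponent G Y C → IsComponent G Y D → v ∈ C → v ∈ D → C ≡ D
  component-unique compC compD v∈C v∈D = ⊆-antisym (C⊆D compC compD v∈C v∈D) (C⊆D compD compC v∈D v∈C)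
    where
    C⊆D : ∀ {C D v} → IsComponent G Y C → IsComponent G Y D → v ∈ C → v ∈ D → C ⊆ D
    C⊆D (C⊆Y , (_ , walksC) , _) compD v∈C v∈D c∈C = component-closed compD C⊆Y (walksC v∈C c∈C) v∈D

  components-disjoint : ∀ {T} → Unique T → All (IsComponent G Y) T → AllPairs Disjoint T
  components-disjoint []             []              = []
  components-disjoint (C≢T ∷ unique) (compC ∷ comps) =
    All.zipWith (λ (C≢D , compD) {_} v∈C v∈D → C≢D (component-unique compC compD v∈C v∈D)) (C≢T , comps)
    ∷ components-disjoint unique comps

  component-of : ∀ {v} → v ∈ Y → (∀ w → Dec (WalkIn G Y v w)) →
                 ∃ λ D → IsComponent G Y D × (∀ {w} → WalkIn G Y v w → w ∈ D)
  component-of {v} v∈Y reach? = D , (D⊆Y , connD , closed) , reach⇒∈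
    where
    D : Subset n
    D = tabulate (does ∘ reach?)
    reach⇒∈ : ∀ {w} → WalkIn G Y v w → w ∈ D
    reach⇒∈ {w} walk = lookup⇒[]= w D (trans (lookup∘tabulate _ w) (dec-true (reach? w) walk))
    ∈⇒reach : ∀ {w} → w ∈ D → WalkIn G Y v w
    ∈⇒reach {w} w∈D = decidable-stable (reach? w) λ ¬walk →
      contradiction (trans (sym ([]=⇒lookup w∈D)) (trans (lookup∘tabulate _ w) (dec-false (reach? w) ¬walk)))
                    λ ()
    D⊆Y : D ⊆ Y
    D⊆Y = walk-end ∘ ∈⇒reach
    within-D : ∀ {a b} → WalkIn G Y v a → WalkIn G Y a b → WalkIn G D a b
    within-D v⇝a (here _)            = here (reach⇒∈ v⇝a)
    within-D v⇝a (step a∈Y adj walk) =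
      step (reach⇒∈ v⇝a) adj (within-D (v⇝a ++ʷ step a∈Y adj (here (walk-start walk))) walk)
    connD : ConnectedInduced G D
    connD = connected-hub (reach⇒∈ (here v∈Y)) λ w∈D → within-D (∈⇒reach w∈D) (reverseʷ (∈⇒reach w∈D))
    closed : ∀ {u w} → u ∈ D → w ∈ Y → Adj G u w → w ∈ D
    closed u∈D w∈Y adj = reach⇒∈ (∈⇒reach u∈D ++ʷ step (D⊆Y u∈D) adj (here w∈Y))

  -- Adjacency is not assumed decidable, so components exist only up to double negation.
  ¬¬-component-⊇ : ∀ {C} → ConnectedInduced G C → C ⊆ Y → ¬ ¬ (∃ λ D → IsComponent G Y D × C ⊆ D)
  ¬¬-component-⊇ {C} ((v , v∈C) , walksC) C⊆Y = ¬¬-map component-⊇ ¬¬-decidable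
    where
    component-⊇ : (∀ w → Dec (WalkIn G Y v w)) → ∃ λ D → IsComponent G Y D × C ⊆ D
    component-⊇ reach? with component-of (C⊆Y v∈C) reach?
    ... | D , compD , reach⇒∈ = D , compD , λ c∈C → reach⇒∈ (walk-lift C⊆Y (walksC v∈C c∈C))

-- Rounding a feasible solution

round : ∀ {n} → Subset n → Subset n → (Fin n → ℚ) → Fin n → ℚ
round X Y x v = if lookup X v then 1ℚ else (if lookup Y v then 0ℚ else x v)

module _ {ℓ n} {G : Graph n} {X Y : Subset n}
         (N[Y]⊆X : ∀ {y v} → y ∈ Y → v ∉ Y → Adj G y v → v ∈ X)
         (components-small : ∀ C → IsComponent G Y C → ∣ C ∣ ≤ ℓ) where

  walk-avoiding-X-stays-in-Y : ∀ {S a b} → Disjoint S X → WalkIn G S a b → a ∈ Y → b ∈ Y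
  walk-avoiding-X-stays-in-Y S∩X=∅ (here _)                  a∈Y = a∈Y
  walk-avoiding-X-stays-in-Y S∩X=∅ (step {w = w} _ adj walk) a∈Y with w ∈? Y
  ... | yes w∈Y = walk-avoiding-X-stays-in-Y S∩X=∅ walk w∈Y
  ... | no  w∉Y = contradiction (N[Y]⊆X a∈Y w∉Y adj) (S∩X=∅ (walk-start walk))

  round-feasible : ∀ {x} → Feasible ℓ G x → Feasible ℓ G (round X Y x)
  round-feasible {x} (bounds , covers) = bounds′ , covers′
    where
    0≤1 : 0ℚ ≤ℚ 1ℚ
    0≤1 = ℚ.<⇒≤ (ℚ.positive⁻¹ 1ℚ)
    bounds′ : ∀ v → 0ℚ ≤ℚ round X Y x v × round X Y x v ≤ℚ 1ℚ
    bounds′ v with lookup X v | lookup Y v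
    ... | true  | _     = 0≤1 , ℚ.≤-refl
    ... | false | true  = ℚ.≤-refl , 0≤1
    ... | false | false = bounds v
    covers′ : ∀ C → ∣ C ∣ ≡ suc ℓ → ConnectedInduced G C → 1ℚ ≤ℚ sumOver C (round X Y x)
    covers′ C ∣C∣≡1+ℓ connC with any? (λ v → (v ∈? C) ×-dec (v ∈? X))
    ... | yes (v , v∈C , v∈X) =
      subst (_≤ℚ sumOver C (round X Y x)) (cong (λ b → if b then 1ℚ else _) ([]=⇒lookup v∈X))
            (term≤sumOver (proj₁ ∘ bounds′) v∈C)
    ... | no C∩X=∅ with any? (λ v → (v ∈? C) ×-dec (v ∈? Y))
    ...   | yes (v , v∈C , v∈Y) = ⊥-elim (¬¬-component-⊇ connC C⊆Y too-large)
      where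
      C⊆Y : C ⊆ Y
      C⊆Y c∈C = walk-avoiding-X-stays-in-Y (λ u∈C u∈X → C∩X=∅ (_ , u∈C , u∈X)) (proj₂ connC v∈C c∈C) v∈Y
      too-large : ¬ (∃ λ D → IsComponent G Y D × C ⊆ D)
      too-large (D , compD , C⊆D) =
        ℕ.<⇒≱ (ℕ.≤-reflexive (sym ∣C∣≡1+ℓ)) (ℕ.≤-trans (p⊆q⇒∣p∣≤∣q∣ C⊆D) (components-small D compD))
    ...   | no C∩Y=∅ = subst (1ℚ ≤ℚ_) (sumOver-cong x x≡round) (covers C ∣C∣≡1+ℓ connC)
      where
      x≡round : ∀ {v} → v ∈ C → x v ≡ round X Y x v
      x≡round {v} v∈C rewrite ∉⇒lookup≡false (λ v∈X → C∩X=∅ (v , v∈C , v∈X))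
                            | ∉⇒lookup≡false (λ v∈Y → C∩Y=∅ (v , v∈C , v∈Y)) = refl

-- The greedy threshold argument

module Greedy {I : Set} (m w : I → ℕ) (d : I → ℚ)
              (w≤m : ∀ i → w i ≤ m i) (0≤d : ∀ i → 0ℚ ≤ℚ d i) where

  mass : List I → ℚ
  mass = Σℚ.sum (λ i → m i · d i)

  weighted : List I → ℚ
  weighted = Σℚ.sum (λ i → w i · d i)

  PrefixBound : ℕ → ℚ → ℚ → List I → Set
  PrefixBound ℓ a c L = ∀ k → ℓ ≤ Σℕ.sum m (take k L) → a ≤ℚ c +ℚ mass (take k L)

  -- V units at the threshold density d i cover the demand a − c, and the weighted mass of L
  -- exceeds the demand by e more such units.
  Threshold : ℕ → ℕ → ℚ → ℚ → List I → I → Set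
  Threshold V e a c L i = a ≤ℚ c +ℚ V · d i × a +ℚ e · d i ≤ℚ c +ℚ weighted L

  weighted-≥ : ∀ {δ} L → All (λ i → δ ≤ℚ d i) L → Σℕ.sum w L · δ ≤ℚ weighted L
  weighted-≥ {δ} L δ≤d = subst (_≤ℚ weighted L) (Σℚ-· w δ L) (Σℚ-mono-≤ (All.map (·-monoʳ-≤ (w _)) δ≤d))

  threshold-head : ∀ {ℓ V e a c y L} → All (λ i → d y ≤ℚ d i) L → m y + ℓ ≤ suc V → 1 ≤ ℓ → ℓ ≤ m y →
                   Σℕ.sum w (y ∷ L) ≡ V + e → PrefixBound ℓ a c (y ∷ L) → Threshold V e a c (y ∷ L) y
  threshold-head {ℓ} {V} {e} {a} {c} {y} {L} y≤L my+ℓ≤1+V 1≤ℓ ℓ≤my Σw≡V+e prefix = a≤ , a+≤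
    where
    open ℚ.≤-Reasoning
    my≤V : m y ≤ V
    my≤V = ℕ.≤-pred (ℕ.≤-trans (subst (_≤ m y + ℓ) (ℕ.+-comm (m y) 1) (ℕ.+-monoʳ-≤ (m y) 1≤ℓ)) my+ℓ≤1+V)
    a≤ : a ≤ℚ c +ℚ V · d y
    a≤ = begin
      a                       ≤⟨ prefix 1 (subst (ℓ ≤_) (sym (ℕ.+-identityʳ (m y))) ℓ≤my) ⟩
      c +ℚ (m y · d y +ℚ 0ℚ)  ≡⟨ cong (c +ℚ_) (ℚ.+-identityʳ _) ⟩
      c +ℚ m y · d y          ≤⟨ ℚ.+-monoʳ-≤ c (·-monoˡ-≤ (0≤d y) my≤V) ⟩
      c +ℚ V · d y            ∎
    a+≤ : a +ℚ e · d y ≤ℚ c +ℚ weighted (y ∷ L)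
    a+≤ = begin
      a +ℚ e · d y                 ≤⟨ ℚ.+-monoˡ-≤ (e · d y) a≤ ⟩
      (c +ℚ V · d y) +ℚ e · d y    ≡⟨ ℚ.+-assoc c _ _ ⟩
      c +ℚ (V · d y +ℚ e · d y)    ≡⟨ cong (c +ℚ_) (sym (·-homo-+ (d y) V e)) ⟩
      c +ℚ (V + e) · d y           ≡⟨ cong (λ k → c +ℚ k · d y) (sym Σw≡V+e) ⟩
      c +ℚ Σℕ.sum w (y ∷ L) · d y  ≤⟨ ℚ.+-monoʳ-≤ c (weighted-≥ (y ∷ L) (ℚ.≤-refl ∷ y≤L)) ⟩
      c +ℚ weighted (y ∷ L)        ∎

  -- The g = m y − w y units of size of y not covered by its weight are paid at the threshold density.
  threshold-cons : ∀ {V′ e g a c y L} → All (λ i → d y ≤ℚ d i) L → w y + g ≡ m y →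
                   (∃ λ i → i ∈ₗ L × Threshold V′ (e + g) a (c +ℚ m y · d y) L i) →
                   ∃ λ i → i ∈ₗ y ∷ L × Threshold (m y + V′) e a c (y ∷ L) i
  threshold-cons {V′} {e} {g} {a} {c} {y} {L} y≤L wy+g≡my (i , i∈L , a≤ , a+≤) = i , there i∈L , a≤′ , a+≤′
    where
    open ℚ.≤-Reasoning
    dy≤di : d y ≤ℚ d i
    dy≤di = All.lookup y≤L i∈L
    a≤′ : a ≤ℚ c +ℚ (m y + V′) · d i
    a≤′ = begin
      a                             ≤⟨ a≤ ⟩
      (c +ℚ m y · d y) +ℚ V′ · d i  ≤⟨ ℚ.+-monoˡ-≤ (V′ · d i) (ℚ.+-monoʳ-≤ c (·-monoʳ-≤ (m y) dy≤di)) ⟩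
      (c +ℚ m y · d i) +ℚ V′ · d i  ≡⟨ ℚ.+-assoc c _ _ ⟩
      c +ℚ (m y · d i +ℚ V′ · d i)  ≡⟨ cong (c +ℚ_) (sym (·-homo-+ (d i) (m y) V′)) ⟩
      c +ℚ (m y + V′) · d i         ∎
    a+≤′ : a +ℚ e · d i ≤ℚ c +ℚ weighted (y ∷ L)
    a+≤′ = +-cancelʳ-≤ (g · d i) (begin
      (a +ℚ e · d i) +ℚ g · d i                    ≡⟨ ℚ.+-assoc a _ _ ⟩
      a +ℚ (e · d i +ℚ g · d i)                    ≡⟨ cong (a +ℚ_) (sym (·-homo-+ (d i) e g)) ⟩
      a +ℚ (e + g) · d i                           ≤⟨ a+≤ ⟩
      (c +ℚ m y · d y) +ℚ weighted L
        ≡⟨ cong (λ k → (c +ℚ k · d y) +ℚ weighted L) (sym wy+g≡my) ⟩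
      (c +ℚ (w y + g) · d y) +ℚ weighted L
        ≡⟨ cong (λ q → (c +ℚ q) +ℚ weighted L) (·-homo-+ (d y) (w y) g) ⟩
      (c +ℚ (w y · d y +ℚ g · d y)) +ℚ weighted L
        ≤⟨ ℚ.+-monoˡ-≤ (weighted L) (ℚ.+-monoʳ-≤ c (ℚ.+-monoʳ-≤ (w y · d y) (·-monoʳ-≤ g dy≤di))) ⟩
      (c +ℚ (w y · d y +ℚ g · d i)) +ℚ weighted L
        ≡⟨ ℚ.+-assoc c _ _ ⟩
      c +ℚ ((w y · d y +ℚ g · d i) +ℚ weighted L)
        ≡⟨ cong (c +ℚ_) (xy∙z≈xz∙y (w y · d y) (g · d i) (weighted L)) ⟩
      c +ℚ ((w y · d y +ℚ weighted L) +ℚ g · d i)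
        ≡⟨ sym (ℚ.+-assoc c _ _) ⟩
      (c +ℚ weighted (y ∷ L)) +ℚ g · d i
        ∎)

  -- Take the items in order of density until their sizes reach ℓ; c is the mass already taken.
  threshold : ∀ {ℓ V e a c} L → AllPairs (λ i j → d i ≤ℚ d j) L → All (λ i → m i + ℓ ≤ suc V) L →
              1 ≤ ℓ → ℓ ≤ V → Σℕ.sum w L ≡ V + e → PrefixBound ℓ a c L →
              ∃ λ i → i ∈ₗ L × Threshold V e a c L i
  threshold {V = V} {e} [] _ _ 1≤ℓ ℓ≤V 0≡V+e _ =
    contradiction (subst (1 ≤_) (sym 0≡V+e) (ℕ.≤-trans (ℕ.≤-trans 1≤ℓ ℓ≤V) (ℕ.m≤m+n V e))) λ ()
  threshold {ℓ} {V} {e} {a} {c} (y ∷ L) (y≤L ∷ sorted) (bound ∷ bounds) 1≤ℓ ℓ≤V Σw≡V+e prefix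
    with ℓ ℕ.≤? m y
  ... | yes ℓ≤my = y , here refl , threshold-head {a = a} {c} y≤L bound 1≤ℓ ℓ≤my Σw≡V+e prefix
  ... | no  ℓ≰my with ℕ.m≤n⇒∃[o]m+o≡n (ℕ.<⇒≤ (ℕ.≰⇒> ℓ≰my))
  ...   | ℓ′ , refl with ℕ.m≤n⇒∃[o]m+o≡n (ℕ.m+n≤o⇒m≤o (m y) ℓ≤V)
  ...     | V′ , refl with ℕ.m≤n⇒∃[o]m+o≡n (w≤m y)
  ...       | g , wy+g≡my = threshold-cons {e = e} {a = a} {c} y≤L wy+g≡my
    (threshold {ℓ′} {V′} {e + g} {a} {c +ℚ m y · d y} L sorted bounds′ 1≤ℓ′ ℓ′≤V′ Σw′ prefix′)
    where
    bounds′ : All (λ i → m i + ℓ′ ≤ suc V′) L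
    bounds′ = All.map (λ {i} b → ℕ.+-cancelˡ-≤ (m y) _ _
      (subst₂ _≤_ (x+[y+z]≡y+[x+z] (m i) (m y) ℓ′) (sym (ℕ.+-suc (m y) V′)) b)) bounds
      where
      x+[y+z]≡y+[x+z] : ∀ x y z → x + (y + z) ≡ y + (x + z)
      x+[y+z]≡y+[x+z] = solve-∀
    1≤ℓ′ : 1 ≤ ℓ′
    1≤ℓ′ = ℕ.n≢0⇒n>0 λ { refl → ℓ≰my (ℕ.≤-reflexive (ℕ.+-identityʳ (m y))) }
    ℓ′≤V′ : ℓ′ ≤ V′
    ℓ′≤V′ = ℕ.+-cancelˡ-≤ (m y) _ _ ℓ≤V
    Σw′ : Σℕ.sum w L ≡ V′ + (e + g)
    Σw′ = ℕ.+-cancelˡ-≡ (w y) _ _ (begin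
      w y + Σℕ.sum w L      ≡⟨ Σw≡V+e ⟩
      (m y + V′) + e        ≡⟨ cong (λ k → (k + V′) + e) (sym wy+g≡my) ⟩
      ((w y + g) + V′) + e  ≡⟨ rearrange (w y) g V′ e ⟩
      w y + (V′ + (e + g))  ∎)
      where
      open ≡-Reasoning
      rearrange : ∀ a b c d → ((a + b) + c) + d ≡ a + (c + (d + b))
      rearrange = solve-∀
    prefix′ : PrefixBound ℓ′ a (c +ℚ m y · d y) L
    prefix′ k ℓ′≤ = ℚ.≤-trans (prefix (suc k) (ℕ.+-monoʳ-≤ (m y) ℓ′≤)) (ℚ.≤-reflexive (sym (ℚ.+-assoc c _ _)))

allSubsets-unique : ∀ n → Unique (allSubsets n)
allSubsets-unique zero    = [] ∷ []
allSubsets-unique (suc n) =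
  Unique.++⁺ (Unique.map⁺ Vec.∷-injectiveʳ (allSubsets-unique n))
             (Unique.map⁺ Vec.∷-injectiveʳ (allSubsets-unique n))
             heads-differ
  where
  heads-differ : ∀ {S} → ¬ (S ∈ₗ map (true ∷_) (allSubsets n) × S ∈ₗ map (false ∷_) (allSubsets n))
  heads-differ (S∈ₜ , S∈f) with ∈-map⁻ (true ∷_) S∈ₜ | ∈-map⁻ (false ∷_) S∈f
  ... | _ , _ , refl | _ , _ , ()

suc[2*ℓ∸1]≡ℓ+ℓ : ∀ {ℓ} → 1 ≤ ℓ → suc (2 * ℓ ∸ 1) ≡ ℓ + ℓ
suc[2*ℓ∸1]≡ℓ+ℓ {suc k} _ = cong (λ z → suc (k + suc z)) (ℕ.+-identityʳ k)

module Expansion {ℓ n} {G : Graph n} {X Y : Subset n} (1≤ℓ : 1 ≤ ℓ)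
                 (X∩Y=∅ : ∀ {v} → v ∈ X → v ∉ Y)
                 (components-small : ∀ C → IsComponent G Y C → ∣ C ∣ ≤ ℓ)
                 (E : WeightedExpansion G X Y (2 * ℓ ∸ 1))
                 {x : Fin n → ℚ} (feasible : Feasible ℓ G x) where

  open WeightedExpansion E

  V : ℕ
  V = 2 * ℓ ∸ 1

  0≤x : ∀ v → 0ℚ ≤ℚ x v
  0≤x = proj₁ ∘ proj₁ feasible

  density : Subset n → ℚ
  density C = mean (sumOver C x) ∣ C ∣

  load : Fin n → ℚ
  load u = Σℚ.sum (λ C → f u C · density C) (allSubsets n)

  0≤density : ∀ C → 0ℚ ≤ℚ density C
  0≤density C = 0≤mean ∣ C ∣ (sumOver-nonneg 0≤x C)

  0≤load : ∀ u → 0ℚ ≤ℚ load u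
  0≤load u = Σℚ-nonneg (λ C → ·-nonneg (f u C) (0≤density C)) (allSubsets n)

  ·-density : ∀ {C} → IsComponent G Y C → ∣ C ∣ · density C ≡ sumOver C x
  ·-density (_ , ((v , v∈C) , _) , _) = ·-mean _ (ℕ.≤-<-trans z≤n (x∈p⇒∣p-x∣<∣p∣ v∈C))

  component-of-support : ∀ {u C} → f u C ≢ 0 → IsComponent G Y C
  component-of-support {u} {C} f≢0 = proj₁ (proj₂ (support u C f≢0))

  f≤∣C∣ : ∀ u C → f u C ≤ ∣ C ∣
  f≤∣C∣ u C with f u C ℕ.≟ 0
  ... | yes f≡0 = subst (_≤ ∣ C ∣) (sym f≡0) z≤n
  ... | no  f≢0 = ℕ.≤-trans (term≤sumℕ (λ v → f v C) u) (capacity C (component-of-support f≢0))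

  star-bound : ∀ {u} → u ∈ X → ∀ T → Unique T → All (λ C → f u C ≢ 0) T → ℓ ≤ Σℕ.sum ∣_∣ T →
               1ℚ ≤ℚ x u +ℚ Σℚ.sum (λ C → sumOver C x) T
  star-bound {u} u∈X T unique supported ℓ≤ΣT = begin
    1ℚ                                   ≤⟨ feasible-connected feasible (connected-⁅⁆∪⋃ T attached) size ⟩
    sumOver (⁅ u ⁆ ∪ ⋃ T) x              ≡⟨ sumOver-∪ x u∉⋃T ⟩
    sumOver ⁅ u ⁆ x +ℚ sumOver (⋃ T) x   ≡⟨ cong₂ _+ℚ_ (sumOver-⁅⁆ x u) (sumOver-⋃ x T disjoint) ⟩
    x u +ℚ Σℚ.sum (λ C → sumOver C x) T  ∎
    where
    open ℚ.≤-Reasoning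
    components : All (IsComponent G Y) T
    components = All.map component-of-support supported
    disjoint : AllPairs Disjoint T
    disjoint = components-disjoint unique components
    attached : All (Attached u) T
    attached = All.map (λ {C} f≢0 → proj₁ (proj₂ (component-of-support f≢0)) , proj₂ (proj₂ (support u C f≢0)))
                       supported
    u∉⋃T : Disjoint ⁅ u ⁆ (⋃ T)
    u∉⋃T v∈⁅u⁆ = X∩Y=∅ (⁅⁆⊆ u∈X v∈⁅u⁆) ∘ ⋃⊆ T (All.map proj₁ components)
    size : suc ℓ ≤ ∣ ⁅ u ⁆ ∪ ⋃ T ∣
    size = subst (suc ℓ ≤_)
                 (sym (trans (∣∪∣-disjoint ⁅ u ⁆ (⋃ T) u∉⋃T) (cong₂ _+_ (∣⁅x⁆∣≡1 u) (∣⋃∣-disjoint T disjoint))))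
                 (s≤s ℓ≤ΣT)

  open import Data.List.Sort (On.decTotalOrder ℚ.≤-decTotalOrder density) using (sort; sort-↭; sort-↗)

  neighbours : Fin n → List (Subset n)
  neighbours u = sort (filter (λ C → ¬? (f u C ℕ.≟ 0)) (allSubsets n))

  neighbours-sorted : ∀ u → AllPairs (λ C D → density C ≤ℚ density D) (neighbours u)
  neighbours-sorted u = Linked⇒AllPairs ℚ.≤-trans (sort-↗ _)

  neighbours-unique : ∀ u → Unique (neighbours u)
  neighbours-unique u = ↭ₛ.Unique-resp-↭ (setoid (Subset n)) (↭.↭⇒↭ₛ (↭.↭-sym (sort-↭ _)))
                                          (Unique.filter⁺ _ (allSubsets-unique n))

  neighbours-supported : ∀ u → All (λ C → f u C ≢ 0) (neighbours u)
  neighbours-supported u = ↭.All-resp-↭ (↭.↭-sym (sort-↭ _)) (All.all-filter _ (allSubsets n))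

  Σℕ-neighbours : ∀ u → Σℕ.sum (f u) (neighbours u) ≡ sumSubsets (f u)
  Σℕ-neighbours u = trans (Σℕ.sum-↭ (f u) (sort-↭ _))
    (Σℕ.sum-filter (f u) _ (λ C → decidable-stable (f u C ℕ.≟ 0)) (allSubsets n))

  Σℚ-neighbours : ∀ u → Σℚ.sum (λ C → f u C · density C) (neighbours u) ≡ load u
  Σℚ-neighbours u = trans (Σℚ.sum-↭ (λ C → f u C · density C) (sort-↭ _))
    (Σℚ.sum-filter (λ C → f u C · density C) _
                   (λ C ¬f≢0 → cong (_· density C) (decidable-stable (f u C ℕ.≟ 0) ¬f≢0)) (allSubsets n))

  load-threshold : ∀ {u e} → u ∈ X → V + e ≡ sumSubsets (f u) →
                   ∃ λ δ → 0ℚ ≤ℚ δ × 1ℚ ≤ℚ x u +ℚ V · δ × 1ℚ +ℚ e · δ ≤ℚ x u +ℚ load u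
  load-threshold {u} {e} u∈X V+e≡Σf
    with threshold {ℓ} {V} {e} {1ℚ} {x u} (neighbours u) (neighbours-sorted u) bounds 1≤ℓ ℓ≤V
                   (trans (Σℕ-neighbours u) (sym V+e≡Σf)) prefix
    where
    open Greedy ∣_∣ (f u) density (f≤∣C∣ u) 0≤density
    1+V≡ℓ+ℓ : suc V ≡ ℓ + ℓ
    1+V≡ℓ+ℓ = suc[2*ℓ∸1]≡ℓ+ℓ 1≤ℓ
    ℓ≤V : ℓ ≤ V
    ℓ≤V = ℕ.≤-pred (subst₂ _≤_ (ℕ.+-comm ℓ 1) (sym 1+V≡ℓ+ℓ) (ℕ.+-monoʳ-≤ ℓ 1≤ℓ))
    bounds : All (λ C → ∣ C ∣ + ℓ ≤ suc V) (neighbours u)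
    bounds = All.map (λ {C} f≢0 → subst (∣ C ∣ + ℓ ≤_) (sym 1+V≡ℓ+ℓ)
                                        (ℕ.+-monoˡ-≤ ℓ (components-small C (component-of-support f≢0))))
                     (neighbours-supported u)
    prefix : PrefixBound ℓ 1ℚ (x u) (neighbours u)
    prefix k ℓ≤Σ =
      ℚ.≤-trans (star-bound u∈X (take k (neighbours u)) (Unique.take⁺ k (neighbours-unique u)) supported ℓ≤Σ)
                (ℚ.+-monoʳ-≤ (x u) (Σℚ-mono-≤ (All.map sumOver≤·density supported)))
      where
      supported : All (λ C → f u C ≢ 0) (take k (neighbours u))
      supported = All.take⁺ k (neighbours-supported u)
      sumOver≤·density : ∀ {C} → f u C ≢ 0 → sumOver C x ≤ℚ ∣ C ∣ · density C
      sumOver≤·density = ℚ.≤-reflexive ∘ sym ∘ ·-density ∘ component-of-support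
  ... | C , _ , 1≤ , 1+≤ =
    density C , 0≤density C , 1≤ , subst (λ q → 1ℚ +ℚ e · density C ≤ℚ x u +ℚ q) (Σℚ-neighbours u) 1+≤

  load-bound : ∀ {u} → u ∈ X → 1ℚ ≤ℚ x u +ℚ load u
  load-bound {u} u∈X with ℕ.m≤n⇒∃[o]m+o≡n (demand u u∈X)
  ... | e , V+e≡Σf with load-threshold u∈X V+e≡Σf
  ... | δ , 0≤δ , _ , 1+eδ≤ =
    ℚ.≤-trans (subst (_≤ℚ 1ℚ +ℚ e · δ) (ℚ.+-identityʳ 1ℚ) (ℚ.+-monoʳ-≤ 1ℚ (·-nonneg e 0≤δ))) 1+eδ≤

  load-bound-strict : ∀ {u} → u ∈ X → suc V ≤ sumSubsets (f u) → x u <ℚ 1ℚ → 1ℚ <ℚ x u +ℚ load u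
  load-bound-strict {u} u∈X 1+V≤Σf xu<1 with ℕ.m≤n⇒∃[o]m+o≡n 1+V≤Σf
  ... | e , 1+V+e≡Σf with load-threshold u∈X (trans (ℕ.+-suc V e) 1+V+e≡Σf)
  ... | δ , _ , 1≤xu+Vδ , 1+eδ≤ =
    ℚ.<-≤-trans (subst (_<ℚ 1ℚ +ℚ suc e · δ) (ℚ.+-identityʳ 1ℚ) (ℚ.+-monoʳ-< 1ℚ (·-pos e 0<δ))) 1+eδ≤
    where
    0<δ : 0ℚ <ℚ δ
    0<δ = ℚ.≰⇒> λ δ≤0 → ℚ.<-irrefl refl (ℚ.<-≤-trans xu<1 (begin
      1ℚ             ≤⟨ 1≤xu+Vδ ⟩
      x u +ℚ V · δ   ≤⟨ ℚ.+-monoʳ-≤ (x u) (·-monoʳ-≤ V δ≤0) ⟩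
      x u +ℚ V · 0ℚ  ≡⟨ cong (x u +ℚ_) (·-zeroʳ V) ⟩
      x u +ℚ 0ℚ      ≡⟨ ℚ.+-identityʳ (x u) ⟩
      x u            ∎))
      where open ℚ.≤-Reasoning

  received : Subset n → ℕ
  received C = sumℕ (λ v → f v C)

  component-of-received : ∀ {C} → received C ≢ 0 → IsComponent G Y C
  component-of-received {C} received≢0 = component-of-support (proj₂ (sumℕ≢0⇒term≢0 (λ v → f v C) received≢0))

  total-load : sumℚ load ≤ℚ sumOver Y x
  total-load = begin
    sumℚ load
      ≡⟨ sym (Σℚ-sumℚ-comm (λ C v → f v C · density C) (allSubsets n)) ⟩
    Σℚ.sum (λ C → sumℚ (λ v → f v C · density C)) (allSubsets n)
      ≡⟨ Σℚ.sum-cong (λ C → sumℚ-· (λ v → f v C) (density C)) (allSubsets n) ⟩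
    Σℚ.sum (λ C → received C · density C) (allSubsets n)
      ≡⟨ sym (Σℚ.sum-filter (λ C → received C · density C) received? unreceived (allSubsets n)) ⟩
    Σℚ.sum (λ C → received C · density C) used
      ≤⟨ Σℚ-mono-≤ (All.map received·density≤ (All.all-filter received? (allSubsets n))) ⟩
    Σℚ.sum (λ C → sumOver C x) used
      ≡⟨ sym (sumOver-⋃ x used (components-disjoint used-unique used-components)) ⟩
    sumOver (⋃ used) x
      ≤⟨ sumOver-mono-⊆ 0≤x (⋃⊆ used (All.map proj₁ used-components)) ⟩
    sumOver Y x
      ∎
    where
    open ℚ.≤-Reasoning
    received? : Decidable (λ C → received C ≢ 0)
    received? C = ¬? (received C ℕ.≟ 0)
    unreceived : ∀ C → ¬ (received C ≢ 0) → received C · density C ≡ 0ℚ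
    unreceived C ¬received≢0 = cong (_· density C) (decidable-stable (received C ℕ.≟ 0) ¬received≢0)
    received·density≤ : ∀ {C} → received C ≢ 0 → received C · density C ≤ℚ sumOver C x
    received·density≤ {C} received≢0 =
      ℚ.≤-trans (·-monoˡ-≤ (0≤density C) (capacity C component)) (ℚ.≤-reflexive (·-density component))
      where
      component : IsComponent G Y C
      component = component-of-received received≢0
    used : List (Subset n)
    used = filter received? (allSubsets n)
    used-unique : Unique used
    used-unique = Unique.filter⁺ received? (allSubsets-unique n)
    used-components : All (IsComponent G Y) used
    used-components = All.map component-of-received (All.all-filter received? (allSubsets n))

  rounding-gain : ∀ {r} → r ∈ X → suc V ≤ sumSubsets (f r) → x r <ℚ 1ℚ →
                  sumℚ (round X Y x) +ℚ sumOver Y x <ℚ sumℚ x +ℚ sumOver Y x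
  rounding-gain {r} r∈X 1+V≤Σf xr<1 = begin-strict
    sumℚ (round X Y x) +ℚ sumOver Y x       ≡⟨ sym (sumℚ-+ (round X Y x) (x ↾ Y)) ⟩
    sumℚ (λ v → round X Y x v +ℚ (x ↾ Y) v)  <⟨ sumℚ-mono-< pointwise r strict-at-r ⟩
    sumℚ (λ v → x v +ℚ load v)               ≡⟨ sumℚ-+ x load ⟩
    sumℚ x +ℚ sumℚ load                      ≤⟨ ℚ.+-monoʳ-≤ (sumℚ x) total-load ⟩
    sumℚ x +ℚ sumOver Y x                    ∎
    where
    open ℚ.≤-Reasoning
    pointwise : ∀ v → round X Y x v +ℚ (x ↾ Y) v ≤ℚ x v +ℚ load v
    pointwise v with lookup X v in eqX | lookup Y v in eqY
    ... | true  | true  = contradiction (lookup⇒[]= v Y eqY) (X∩Y=∅ (lookup⇒[]= v X eqX))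
    ... | true  | false = load-bound (lookup⇒[]= v X eqX)
    ... | false | true  = ℚ.≤-trans (ℚ.≤-reflexive (ℚ.+-comm 0ℚ (x v))) (ℚ.+-monoʳ-≤ (x v) (0≤load v))
    ... | false | false = ℚ.+-monoʳ-≤ (x v) (0≤load v)
    strict-at-r : round X Y x r +ℚ (x ↾ Y) r <ℚ x r +ℚ load r
    strict-at-r rewrite []=⇒lookup r∈X | ∉⇒lookup≡false (X∩Y=∅ r∈X) = load-bound-strict r∈X 1+V≤Σf xr<1

lemma20 : (ℓ : ℕ) → 1 ≤ ℓ → (n : ℕ) (G : Graph n) (X Y : Subset n) →
    StrictReduciblePair ℓ G X Y →
    (x : Fin n → ℚ) → Optimal ℓ G x →
    ∃ λ v → v ∈ X × x v ≡ 1ℚ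
lemma20 ℓ 1≤ℓ n G X Y (X∩Y=∅ , N[Y]⊆X , components-small , E , r , r∈X , 1+V≤Σf) x (feasible , optimal) =
  r , r∈X , ℚ.≤-antisym (proj₂ (proj₁ feasible r)) (ℚ.≮⇒≥ xr≮1)
  where
  open Expansion 1≤ℓ X∩Y=∅ components-small E feasible
  xr≮1 : ¬ (x r <ℚ 1ℚ)
  xr≮1 xr<1 = ℚ.<-irrefl refl (ℚ.<-≤-trans (rounding-gain r∈X 1+V≤Σf xr<1)
    (ℚ.+-monoˡ-≤ (sumOver Y x) (optimal (round X Y x) (round-feasible N[Y]⊆X components-small feasible))))
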